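{- Let $P$ be a finite atomic lattice and $\mathcal{M}=\{m_p\}$ a labeling of $P$ by monomials satisfying: (C1) if $p\in\mathrm{mi}(P)$ then $m_p\neq 1$; (C2) if $\gcd(m_p,m_q)\neq 1$ for some $p,q\in P$, then either $p$ and $q$ are comparable, or $r(p)=\dfrac{m_p}{\gcd(m_p,m_q)}\neq 1$ and $r(q)=\dfrac{m_q}{\gcd(m_p,m_q)}\neq 1$, and any two elements $x,y$ both lying in $\{s\in P\setminus\{q\}: \gcd(m_p,m_s)\neq 1\}$, or both lying in $\{s\in P\setminus\{p\}:\gcd(m_q,m_s)\neq1\}$, are comparable. Then $\mathcal{M}$ is a weak coordinatization of $P$.
   Context: A finite atomic lattice is a finite lattice $P$ with least element $0$ and greatest element in which every nonzero element is a join of atoms; $\mathrm{atoms}(P)$ is its set of atoms, and $\mathrm{supp}(p)=\{a\in\mathrm{atoms}(P): a\le p\}$. An element $x\in P$ is meet-irreducible if $x\neq a\wedge b$ for all $a>x$, $b>x$; $\mathrm{mi}(P)$ denotes the set of meet-irreducible elements. For $p\in P$, $\lceil p\rceil=\{q: q\ge p\}$ and $\lceil p\rceil^c=P\setminus\lceil p\rceil$. A labeling $\mathcal{M}$ of $P$ assigns a monomial $m_p$ (in a polynomial ring over a field) to each $p\in P$, unlabeled elements having label $1$. Conventions: $\mathrm{lcm}\,\emptyset=\gcd\emptyset=1$. For $a\in\mathrm{atoms}(P)$ let $x(a)=\prod_{p\in\lceil a\rceil^c}m_p$. For $p\in P$ let $B_p=\{T\subseteq\mathrm{supp}(p): \bigvee_{b\in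 T}b=p\}$, and for $a\in\mathrm{atoms}(P)$ let $\triangle(a)=\gcd\{\mathrm{lcm}\{x(b):b\in T\}: T\in\bigcup_{q\ge a}B_q\}$; $I_{P,\mathcal{M}}$ is the monomial ideal generated by all $\triangle(a)$. The lcm-lattice $LCM(I)$ of a monomial ideal $I$ is the set of least common multiples of subsets of its minimal generators, ordered by divisibility. $\mathcal{M}$ is a weak coordinatization of $P$ if there is a lattice isomorphism $g:P\to LCM(I_{P,\mathcal{M}})$ with $g(a)=\triangle(a)$ for every $a\in\mathrm{atoms}(P)$. -}

module Defs where

open import Level using (0ℓ)
open import Data.Nat using (ℕ; zero; suc; _+_; _≤_; _⊔_; _⊓_; _∸_)
open import Data.Fin using (Fin)
open import Data.Fin.Properties using (all?; any?)
open import Data.Fin.Subset using (Subset; _∈_; inside; outside)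
open import Data.Fin.Subset.Properties using (_∈?_)
open import Data.Vec using (Vec; []; _∷_; replicate; zipWith; lookup)
open import Data.List using (List; []; _∷_; map; foldr; filter; _++_; allFin)
open import Data.List.Relation.Unary.All using (All)
open import Data.Product using (Σ; ∃; _×_; _,_)
open import Data.Sum using (_⊎_)
open import Function.Bundles using (_⇔_)
open import Relation.Nullary using (¬_; Dec; does)
open import Data.Bool using (if_then_else_)
open import Relation.Nullary.Decidable using (¬?; _×-dec_; _⊎-dec_; _→-dec_)
open import Relation.Binary using (Rel; Decidable)
open import Relation.Binary.PropositionalEquality using (_≡_; _≢_)
open import Relation.Binary.Lattice.Structures using (IsBoundedLattice)
open import Algebra.Core using (Op₂)
open import Data.Fin.Properties using (_≟_)

-- Monomials in k variables (over any field): exponent vectors.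

Mon : ℕ → Set
Mon k = Vec ℕ k

module _ {k : ℕ} where

  one : Mon k
  one = replicate k 0

  _·_ : Mon k → Mon k → Mon k
  _·_ = zipWith _+_

  lcmₘ : Mon k → Mon k → Mon k
  lcmₘ = zipWith _⊔_

  gcdₘ : Mon k → Mon k → Mon k
  gcdₘ = zipWith _⊓_

  -- exact quotient m / d (used only when d divides m)
  _/ₘ_ : Mon k → Mon k → Mon k
  _/ₘ_ = zipWith _∸_

  _∣ₘ_ : Mon k → Mon k → Set
  m ∣ₘ m′ = ∀ i → lookup m i ≤ lookup m′ i

  -- product / lcm / gcd of a finite family (given as a list);
  -- empty product = lcm ∅ = gcd ∅ = 1
  prodL : List (Mon k) → Mon k
  prodL = foldr _·_ one

  lcmL : List (Mon k) → Mon k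
  lcmL = foldr lcmₘ one

  gcdL : List (Mon k) → Mon k
  gcdL []       = one
  gcdL (m ∷ ms) = foldr gcdₘ m ms

allSubsets : (n : ℕ) → List (Subset n)
allSubsets zero    = [] ∷ []
allSubsets (suc n) = map (inside ∷_) (allSubsets n) ++ map (outside ∷_) (allSubsets n)

record FinLattice (n : ℕ) : Set₁ where
  field
    _≤ᴾ_ : Rel (Fin n) 0ℓ
    _≤ᴾ?_ : Decidable _≤ᴾ_
    _∨_ : Op₂ (Fin n)
    _∧_ : Op₂ (Fin n)
    ⊤ ⊥ : Fin n
    isBoundedLattice : IsBoundedLattice _≡_ _≤ᴾ_ _∨_ _∧_ ⊤ ⊥

module Lat {n : ℕ} (P : FinLattice n) where
  open FinLattice P public

  _<ᴾ_ : Fin n → Fin n → Set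
  x <ᴾ y = x ≤ᴾ y × x ≢ y

  ⋁ : Subset n → Fin n
  ⋁ S = foldr (λ i acc → if does (i ∈? S) then i ∨ acc else acc) ⊥ (allFin n)

  members : Subset n → List (Fin n)
  members S = filter (_∈? S) (allFin n)

  Comparable : Fin n → Fin n → Set
  Comparable x y = x ≤ᴾ y ⊎ y ≤ᴾ x

  Atom : Fin n → Set
  Atom a = a ≢ ⊥ × (∀ x → x ≤ᴾ a → x ≡ ⊥ ⊎ x ≡ a)

  Atom? : (a : Fin n) → Dec (Atom a)
  Atom? a = ¬? (a ≟ ⊥) ×-dec all? (λ x → (x ≤ᴾ? a) →-dec (x ≟ ⊥ ⊎-dec x ≟ a))

  IsAtomic : Set
  IsAtomic = ∀ p → p ≢ ⊥ → ∃ λ (S : Subset n) → (∀ a → a ∈ S → Atom a) × ⋁ S ≡ p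

  MeetIrr : Fin n → Set
  MeetIrr x = ∀ a b → x <ᴾ a → x <ᴾ b → x ≢ a ∧ b

  InB : Fin n → Subset n → Set
  InB p T = (∀ b → b ∈ T → Atom b × b ≤ᴾ p) × ⋁ T ≡ p

  InB? : ∀ p T → Dec (InB p T)
  InB? p T = all? (λ b → (b ∈? T) →-dec (Atom? b ×-dec (b ≤ᴾ? p))) ×-dec (⋁ T ≟ p)

  InUnionB : Fin n → Subset n → Set
  InUnionB a T = ∃ λ q → a ≤ᴾ q × InB q T

  InUnionB? : ∀ a T → Dec (InUnionB a T)
  InUnionB? a T = any? (λ q → (a ≤ᴾ? q) ×-dec InB? q T)

  module Labeling {k : ℕ} (m : Fin n → Mon k) where

    xₐ : Fin n → Mon k
    xₐ a = prodL (map m (filter (λ p → ¬? (a ≤ᴾ? p)) (allFin n)))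

    △ : Fin n → Mon k
    △ a = gcdL (map (λ T → lcmL (map xₐ (members T)))
                    (filter (InUnionB? a) (allSubsets n)))

    Gen : Mon k → Set
    Gen u = ∃ λ a → Atom a × △ a ≡ u

    MinGen : Mon k → Set
    MinGen u = Gen u × (∀ v → Gen v → v ∣ₘ u → v ≡ u)

    InLCM : Mon k → Set
    InLCM u = ∃ λ (L : List (Mon k)) → All MinGen L × lcmL L ≡ u

    IsJoinIn : Mon k → Mon k → Mon k → Set
    IsJoinIn u v w = InLCM w × u ∣ₘ w × v ∣ₘ w
                     × (∀ z → InLCM z → u ∣ₘ z → v ∣ₘ z → w ∣ₘ z)

    IsMeetIn : Mon k → Mon k → Mon k → Set
    IsMeetIn u v w = InLCM w × w ∣ₘ u × w ∣ₘ v
                     × (∀ z → InLCM z → z ∣ₘ u → z ∣ₘ v → z ∣ₘ w)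

    IsLatticeIso : (Fin n → Mon k) → Set
    IsLatticeIso g =
        (∀ x → InLCM (g x))
      × (∀ x y → g x ≡ g y → x ≡ y)
      × (∀ u → InLCM u → ∃ λ x → g x ≡ u)
      × (∀ x y → IsJoinIn (g x) (g y) (g (x ∨ y)))
      × (∀ x y → IsMeetIn (g x) (g y) (g (x ∧ y)))

    WeakCoordinatization : Set
    WeakCoordinatization =
      ∃ λ (g : Fin n → Mon k) → IsLatticeIso g × (∀ a → Atom a → g a ≡ △ a)

    C1 : Set
    C1 = ∀ p → MeetIrr p → m p ≢ one

    r : Fin n → Fin n → Mon k
    r p q = m p /ₘ gcdₘ (m p) (m q)

    Sgcd : Fin n → Fin n → Fin n → Set
    Sgcd p q s = s ≢ q × gcdₘ (m p) (m s) ≢ one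

    PairwiseComparable : (Fin n → Set) → Set
    PairwiseComparable X = ∀ x y → X x → X y → Comparable x y

    C2 : Set
    C2 = ∀ p q → gcdₘ (m p) (m q) ≢ one →
           Comparable p q
         ⊎ (r p q ≢ one × r q p ≢ one
            × PairwiseComparable (Sgcd p q) × PairwiseComparable (Sgcd q p))

-- The isomorphism is g(p) = lcm {△(a) : a ≤ p an atom}.  It is monotone, equals △ on
-- atoms, and is onto LCM(I): a coordinate of △(c) is the minimum of lcm{x(b) : b ∈ T}
-- over the sets T, so for atoms a₁ … aᵣ the union of the minimising sets covers every
-- atom c below a₁ ∨ … ∨ aᵣ and bounds △(c).
--
-- The heart is that g reflects the order.  If p ≰ q, take ρ ≥ q meet-irreducible with
-- p ≰ ρ.  In a variable j, x(b) has the total degree of the labels outside ⌈b⌉: for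
-- b ≤ ρ this is at most the degree W of the labels outside ⌈ρ⌉, and for b ≰ ρ at least
-- the degree D of the labels of ↓ρ.  Since W + deg m_ρ ≤ D + (degree of labels of
-- elements incomparable to ρ), it suffices that some variable has m_ρ heavier than all
-- incomparable labels together: by (C1) m_ρ ≠ 1, and by (C2) at most one incomparable
-- label shares a variable with m_ρ, and m_ρ has the larger degree in some variable.
-- Then an atom c ≤ p with c ≰ ρ has △(c)_j ≥ D > W ≥ g(q)_j.

module Submission where

open import Defs
open import Data.Nat using (ℕ; zero; suc; _+_; _≤_; _<_; _⊔_; _⊓_; _∸_; z≤n)
open import Data.Nat.Properties as ℕ
  using ( ≤-refl; ≤-trans; ≤-reflexive; <⇒≱; ≤-<-trans; +-mono-≤; +-monoʳ-<; +-cancelʳ-<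
        ; +-identityʳ; m≤m+n; m≤m⊔n; m≤n⊔m; ⊔-lub; m⊓n≤m; m⊓n≤n; ⊓-sel; ⊓-pres-m<; m≤n⇒m⊓n≡m
        ; n≢0⇒n>0; m<n⇒n≢0; ≰⇒>; module ≤-Reasoning)
open import Data.Nat.Induction using (<-wellFounded)
open import Data.Fin using (Fin; zero; suc)
open import Data.Fin.Properties using (_≟_; any?; ¬∀⟶∃¬)
open import Data.Fin.Subset using (Subset; _∈_; ⁅_⁆; _∪_; inside; outside) renaming (⊥ to ∅)
open import Data.Fin.Subset.Properties using (_∈?_; ∉⊥; x∈⁅x⁆; x∈⁅y⁆⇒x≡y; x∈p∪q⁻; x∈p∪q⁺)
open import Data.Vec using ([]; _∷_; lookup)
open import Data.Vec.Properties using (lookup-zipWith; lookup-replicate; tabulate∘lookup; tabulate-cong)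
open import Data.List using (List; []; _∷_; map; foldr; filter; tabulate; allFin)
open import Data.List.Membership.Propositional using () renaming (_∈_ to _∈ₗ_)
open import Data.List.Membership.Propositional.Properties
  using (∈-map⁺; ∈-map⁻; ∈-filter⁺; ∈-filter⁻; ∈-++⁺ˡ; ∈-++⁺ʳ; ∈-allFin)
open import Data.List.Relation.Unary.Any using (here; there)
open import Data.List.Relation.Unary.All as All using (All; []; _∷_)
open import Data.Product using (∃; _×_; _,_; proj₁; proj₂)
open import Data.Sum using (inj₁; inj₂; [_,_]′)
open import Data.Bool using (true; false; if_then_else_)
open import Data.Empty using (⊥-elim)
open import Relation.Nullary using (¬_; Dec; yes; no; does)
open import Relation.Nullary.Decidable using (¬?; _×-dec_; _→-dec_; decidable-stable)
open import Relation.Unary using (Pred; Decidable)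
open import Relation.Binary.PropositionalEquality
  using (_≡_; _≢_; refl; sym; trans; cong; subst; subst₂; module ≡-Reasoning)
open import Relation.Binary.Lattice.Structures using (IsBoundedLattice)
open import Relation.Binary.Construct.On as On using ()
open import Induction.WellFounded using (WellFounded; Acc; acc; module Subrelation)
open import Algebra.Properties.CommutativeMonoid.Sum ℕ.+-0-commutativeMonoid
  using (sum; sum-replicate-zero; ∑-distrib-+)
open import Function using (_∘_; id; flip)

module _ {k : ℕ} where

  lookup-ext : {u v : Mon k} → (∀ i → lookup u i ≡ lookup v i) → u ≡ v
  lookup-ext {u} {v} h = trans (sym (tabulate∘lookup u)) (trans (tabulate-cong h) (tabulate∘lookup v))

  lookup-one : ∀ i → lookup (one {k}) i ≡ 0
  lookup-one i = lookup-replicate i 0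

  lookup-· : ∀ (u v : Mon k) i → lookup (u · v) i ≡ lookup u i + lookup v i
  lookup-· u v i = lookup-zipWith _+_ i u v

  lookup-lcmₘ : ∀ (u v : Mon k) i → lookup (lcmₘ u v) i ≡ lookup u i ⊔ lookup v i
  lookup-lcmₘ u v i = lookup-zipWith _⊔_ i u v

  lookup-gcdₘ : ∀ (u v : Mon k) i → lookup (gcdₘ u v) i ≡ lookup u i ⊓ lookup v i
  lookup-gcdₘ u v i = lookup-zipWith _⊓_ i u v

  ≢one⇒nonzero : ∀ (u : Mon k) → u ≢ one → ∃ λ i → lookup u i ≢ 0
  ≢one⇒nonzero u u≢one = ¬∀⟶∃¬ k _ (λ i → lookup u i ℕ.≟ 0)
    (λ zero-everywhere → u≢one (lookup-ext (λ i → trans (zero-everywhere i) (sym (lookup-one i)))))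

  nonzero⇒≢one : ∀ (u : Mon k) i → lookup u i ≢ 0 → u ≢ one
  nonzero⇒≢one u i uᵢ≢0 refl = uᵢ≢0 (lookup-one i)

  common-variable⇒gcdₘ≢one : ∀ (u v : Mon k) i → lookup u i ≢ 0 → lookup v i ≢ 0 → gcdₘ u v ≢ one
  common-variable⇒gcdₘ≢one u v i uᵢ≢0 vᵢ≢0 = nonzero⇒≢one (gcdₘ u v) i λ gcdᵢ≡0 →
    m<n⇒n≢0 (⊓-pres-m< (n≢0⇒n>0 uᵢ≢0) (n≢0⇒n>0 vᵢ≢0)) (trans (sym (lookup-gcdₘ u v i)) gcdᵢ≡0)

  /ₘgcdₘ≢one⇒exceeds : ∀ (u v : Mon k) → u /ₘ gcdₘ u v ≢ one → ∃ λ i → lookup v i < lookup u i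
  /ₘgcdₘ≢one⇒exceeds u v quotient≢one with ≢one⇒nonzero _ quotient≢one
  ... | i , quotientᵢ≢0 with lookup u i ℕ.≤? lookup v i
  ...   | no uᵢ≰vᵢ = i , ≰⇒> uᵢ≰vᵢ
  ...   | yes uᵢ≤vᵢ = ⊥-elim (quotientᵢ≢0 (begin
      lookup (u /ₘ gcdₘ u v) i            ≡⟨ lookup-zipWith _∸_ i u (gcdₘ u v) ⟩
      lookup u i ∸ lookup (gcdₘ u v) i    ≡⟨ cong (lookup u i ∸_) (lookup-gcdₘ u v i) ⟩
      lookup u i ∸ (lookup u i ⊓ lookup v i) ≡⟨ cong (lookup u i ∸_) (m≤n⇒m⊓n≡m uᵢ≤vᵢ) ⟩
      lookup u i ∸ lookup u i             ≡⟨ ℕ.n∸n≡0 (lookup u i) ⟩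
      0                                   ∎))
    where open ≡-Reasoning

  module _ (j : Fin k) where

    lcmL-ub : ∀ {L u} → u ∈ₗ L → lookup u j ≤ lookup (lcmL L) j
    lcmL-ub {v ∷ L} u∈L rewrite lookup-lcmₘ v (lcmL L) j with u∈L
    ... | here refl = m≤m⊔n _ _
    ... | there u∈L′ = ≤-trans (lcmL-ub u∈L′) (m≤n⊔m _ _)

    lcmL-lub : ∀ {b} L → (∀ {u} → u ∈ₗ L → lookup u j ≤ b) → lookup (lcmL L) j ≤ b
    lcmL-lub [] _ rewrite lookup-one j = z≤n
    lcmL-lub (u ∷ L) h rewrite lookup-lcmₘ u (lcmL L) j = ⊔-lub (h (here refl)) (lcmL-lub L (h ∘ there))

    private
      gcd-fold-lb : ∀ x xs {u} → u ∈ₗ x ∷ xs → lookup (foldr gcdₘ x xs) j ≤ lookup u j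
      gcd-fold-lb x [] (here refl) = ≤-refl
      gcd-fold-lb x (y ∷ ys) u∈ rewrite lookup-gcdₘ y (foldr gcdₘ x ys) j with u∈
      ... | here refl = ≤-trans (m⊓n≤n _ _) (gcd-fold-lb x ys (here refl))
      ... | there (here refl) = m⊓n≤m _ _
      ... | there (there u∈ys) = ≤-trans (m⊓n≤n _ _) (gcd-fold-lb x ys (there u∈ys))

      gcd-fold-attained : ∀ x xs → ∃ λ v → v ∈ₗ x ∷ xs × lookup v j ≡ lookup (foldr gcdₘ x xs) j
      gcd-fold-attained x [] = x , here refl , refl
      gcd-fold-attained x (y ∷ ys) rewrite lookup-gcdₘ y (foldr gcdₘ x ys) j
        with ⊓-sel (lookup y j) (lookup (foldr gcdₘ x ys) j) | gcd-fold-attained x ys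
      ... | inj₁ min≡y | _ = y , there (here refl) , sym min≡y
      ... | inj₂ min≡rest | v , here refl , v≡rest = v , here refl , trans v≡rest (sym min≡rest)
      ... | inj₂ min≡rest | v , there v∈ys , v≡rest = v , there (there v∈ys) , trans v≡rest (sym min≡rest)

    gcdL-lb : ∀ {L u} → u ∈ₗ L → lookup (gcdL L) j ≤ lookup u j
    gcdL-lb {x ∷ xs} = gcd-fold-lb x xs

    gcdL-attained : ∀ {L u} → u ∈ₗ L → ∃ λ v → v ∈ₗ L × lookup v j ≡ lookup (gcdL L) j
    gcdL-attained {x ∷ xs} _ = gcd-fold-attained x xs

_when_ : ∀ {p} {P : Set p} → ℕ → Dec P → ℕ
v when P? = if does P? then v else 0

infix 7 _when_

sum-mono-≤ : ∀ {n} {f g : Fin n → ℕ} → (∀ i → f i ≤ g i) → sum f ≤ sum g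
sum-mono-≤ {zero} _ = z≤n
sum-mono-≤ {suc n} f≤g = +-mono-≤ (f≤g zero) (sum-mono-≤ (f≤g ∘ suc))

sum-point : ∀ {n} (f : Fin n → ℕ) u → sum (λ s → f s when (s ≟ u)) ≡ f u
sum-point {suc n} f zero = trans (cong (f zero +_) (sum-replicate-zero n)) (+-identityʳ (f zero))
sum-point {suc n} f (suc u) = sum-point (f ∘ suc) u

when-yes : ∀ {p} {P : Set p} (P? : Dec P) v → P → v when P? ≡ v
when-yes (yes _) v _ = refl
when-yes (no ¬p) v p = ⊥-elim (¬p p)

when-vanishes : ∀ {p} {P : Set p} (P? : Dec P) v → (P → v ≡ 0) → v when P? ≡ 0
when-vanishes (yes p) v v≡0 = v≡0 p
when-vanishes (no _) v _ = refl

when-≤ : ∀ {p} {P : Set p} (P? : Dec P) v → v when P? ≤ v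
when-≤ (yes _) v = ≤-refl
when-≤ (no _) v = z≤n

when-mono : ∀ {p q} {P : Set p} {Q : Set q} (P? : Dec P) (Q? : Dec Q) v → (P → Q) → v when P? ≤ v when Q?
when-mono (yes p) (yes _) v _ = ≤-refl
when-mono (yes p) (no ¬q) v P⇒Q = ⊥-elim (¬q (P⇒Q p))
when-mono (no _) Q? v _ = z≤n

lookup-prodL-filter : ∀ {n k p} {P : Pred (Fin n) p} (P? : Decidable P) (f : Fin n → Mon k) j →
  lookup (prodL (map f (filter P? (allFin n)))) j ≡ sum (λ s → lookup (f s) j when P? s)
lookup-prodL-filter {n} P? f j = go n id
  where
  go : ∀ n′ (h : Fin n′ → Fin _) →
    lookup (prodL (map f (filter P? (tabulate h)))) j ≡ sum (λ s → lookup (f (h s)) j when P? (h s))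
  go zero h = lookup-one j
  go (suc n′) h with does (P? (h zero))
  ... | true = trans (lookup-· (f (h zero)) _ j) (cong (lookup (f (h zero)) j +_) (go n′ (h ∘ suc)))
  ... | false = go n′ (h ∘ suc)

allSubsets-complete : ∀ {n} (T : Subset n) → T ∈ₗ allSubsets n
allSubsets-complete [] = here refl
allSubsets-complete {suc n} (inside ∷ T) = ∈-++⁺ˡ (∈-map⁺ (inside ∷_) (allSubsets-complete T))
allSubsets-complete {suc n} (outside ∷ T) =
  ∈-++⁺ʳ (map (inside ∷_) (allSubsets n)) (∈-map⁺ (outside ∷_) (allSubsets-complete T))

module LatticeFacts {n : ℕ} (P : FinLattice n) where
  open Lat P
  open IsBoundedLattice isBoundedLattice
    using (x≤x∨y; y≤x∨y; ∨-least; ∧-greatest; minimum; antisym; reflexive)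
    renaming (refl to ≤ᴾ-refl; trans to ≤ᴾ-trans)

  _<ᴾ?_ : ∀ x y → Dec (x <ᴾ y)
  x <ᴾ? y = (x ≤ᴾ? y) ×-dec ¬? (x ≟ y)

  Incomparable : Fin n → Fin n → Set
  Incomparable x y = ¬ x ≤ᴾ y × ¬ y ≤ᴾ x

  incomparable? : ∀ x y → Dec (Incomparable x y)
  incomparable? x y = ¬? (x ≤ᴾ? y) ×-dec ¬? (y ≤ᴾ? x)

  private
    join-step : Subset n → Fin n → Fin n → Fin n
    join-step S i rest = if does (i ∈? S) then i ∨ rest else rest

    join-step-ub : ∀ S xs {i} → i ∈ S → i ∈ₗ xs → i ≤ᴾ foldr (join-step S) ⊥ xs
    join-step-ub S (x ∷ xs) i∈S i∈xs with x ∈? S | i∈xs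
    ... | yes _ | here refl = x≤x∨y x _
    ... | yes _ | there i∈xs′ = ≤ᴾ-trans (join-step-ub S xs i∈S i∈xs′) (y≤x∨y x _)
    ... | no x∉S | here refl = ⊥-elim (x∉S i∈S)
    ... | no _ | there i∈xs′ = join-step-ub S xs i∈S i∈xs′

    join-step-lub : ∀ S xs {ρ} → (∀ i → i ∈ S → i ≤ᴾ ρ) → foldr (join-step S) ⊥ xs ≤ᴾ ρ
    join-step-lub S [] _ = minimum _
    join-step-lub S (x ∷ xs) h with x ∈? S
    ... | yes x∈S = ∨-least (h x x∈S) (join-step-lub S xs h)
    ... | no _ = join-step-lub S xs h

  ⋁-ub : ∀ {S i} → i ∈ S → i ≤ᴾ ⋁ S
  ⋁-ub {S} i∈S = join-step-ub S (allFin n) i∈S (∈-allFin _)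

  ⋁-lub : ∀ {S ρ} → (∀ i → i ∈ S → i ≤ᴾ ρ) → ⋁ S ≤ᴾ ρ
  ⋁-lub {S} = join-step-lub S (allFin n)

  ⋁-mono : ∀ {S S′} → (∀ i → i ∈ S → i ∈ S′) → ⋁ S ≤ᴾ ⋁ S′
  ⋁-mono S⊆S′ = ⋁-lub (λ i i∈S → ⋁-ub (S⊆S′ i i∈S))

  ⋁-⁅⁆ : ∀ a → ⋁ ⁅ a ⁆ ≡ a
  ⋁-⁅⁆ a = antisym (⋁-lub (λ i i∈⁅a⁆ → reflexive (x∈⁅y⁆⇒x≡y a i∈⁅a⁆))) (⋁-ub (x∈⁅x⁆ a))

  ⋁≰⇒∃≰ : ∀ {T ρ} → ¬ ⋁ T ≤ᴾ ρ → ∃ λ b → b ∈ T × ¬ b ≤ᴾ ρ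
  ⋁≰⇒∃≰ {T} {ρ} ⋁T≰ρ with ¬∀⟶∃¬ n _ (λ b → (b ∈? T) →-dec (b ≤ᴾ? ρ)) (⋁T≰ρ ∘ ⋁-lub)
  ... | b , ¬[b∈T⇒b≤ρ] with b ∈? T
  ...   | yes b∈T = b , b∈T , λ b≤ρ → ¬[b∈T⇒b≤ρ] (λ _ → b≤ρ)
  ...   | no b∉T = ⊥-elim (¬[b∈T⇒b≤ρ] (⊥-elim ∘ b∉T))

  ⋁ₗ : List (Fin n) → Fin n
  ⋁ₗ = foldr _∨_ ⊥

  ⋁ₗ-ub : ∀ {as a} → a ∈ₗ as → a ≤ᴾ ⋁ₗ as
  ⋁ₗ-ub (here refl) = x≤x∨y _ _
  ⋁ₗ-ub (there a∈as) = ≤ᴾ-trans (⋁ₗ-ub a∈as) (y≤x∨y _ _)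

  <ᴾ-trans : ∀ {x y z} → x <ᴾ y → y <ᴾ z → x <ᴾ z
  <ᴾ-trans (x≤y , x≢y) (y≤z , _) = ≤ᴾ-trans x≤y y≤z , λ { refl → x≢y (antisym x≤y y≤z) }

  _>ᴾ_ : Fin n → Fin n → Set
  _>ᴾ_ = flip _<ᴾ_

  #above : Fin n → ℕ
  #above x = sum (λ s → 1 when (x <ᴾ? s))

  <ᴾ⇒#above> : ∀ {x y} → x <ᴾ y → #above y < #above x
  <ᴾ⇒#above> {x} {y} x<y = begin
    suc (#above y)                                       ≡⟨ ℕ.+-comm 1 (#above y) ⟩
    #above y + 1                                         ≡⟨ cong (#above y +_) (sum-point (λ _ → 1) y) ⟨
    #above y + sum (λ s → 1 when (s ≟ y))                ≡⟨ ∑-distrib-+ (λ s → 1 when (y <ᴾ? s)) (λ s → 1 when (s ≟ y)) ⟨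
    sum (λ s → 1 when (y <ᴾ? s) + 1 when (s ≟ y))        ≤⟨ sum-mono-≤ pointwise ⟩
    #above x                                             ∎
    where
    open ≤-Reasoning
    pointwise : ∀ s → 1 when (y <ᴾ? s) + 1 when (s ≟ y) ≤ 1 when (x <ᴾ? s)
    pointwise s with s ≟ y
    ... | yes refl rewrite when-vanishes (s <ᴾ? s) 1 (λ (_ , s≢s) → ⊥-elim (s≢s refl))
                         | when-yes (x <ᴾ? s) 1 x<y = ≤-refl
    ... | no _ rewrite +-identityʳ (1 when (y <ᴾ? s)) = when-mono (y <ᴾ? s) (x <ᴾ? s) 1 (<ᴾ-trans x<y)

  >ᴾ-wellFounded : WellFounded _>ᴾ_
  >ᴾ-wellFounded = Subrelation.wellFounded <ᴾ⇒#above> (On.wellFounded #above <-wellFounded)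

  -- A maximal element above q and not above p is meet-irreducible.
  meetIrreducible-separator : ∀ {p q} → ¬ p ≤ᴾ q → ∃ λ ρ → MeetIrr ρ × q ≤ᴾ ρ × ¬ p ≤ᴾ ρ
  meetIrreducible-separator {p} {q} p≰q = climb q (>ᴾ-wellFounded q) ≤ᴾ-refl p≰q
    where
    climb : ∀ x → Acc _>ᴾ_ x → q ≤ᴾ x → ¬ p ≤ᴾ x → ∃ λ ρ → MeetIrr ρ × q ≤ᴾ ρ × ¬ p ≤ᴾ ρ
    climb x (acc higher) q≤x p≰x with any? (λ y → (x <ᴾ? y) ×-dec ¬? (p ≤ᴾ? y))
    ... | yes (y , x<y , p≰y) = climb y (higher x<y) (≤ᴾ-trans q≤x (proj₁ x<y)) p≰y
    ... | no maximal = x , meetIrr , q≤x , p≰x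
      where
      p≤above : ∀ {a} → x <ᴾ a → p ≤ᴾ a
      p≤above {a} x<a = decidable-stable (p ≤ᴾ? a) (λ p≰a → maximal (a , x<a , p≰a))
      meetIrr : MeetIrr x
      meetIrr a b x<a x<b x≡a∧b = p≰x (subst (p ≤ᴾ_) (sym x≡a∧b) (∧-greatest (p≤above x<a) (p≤above x<b)))

  outside-or-self≤below-or-incomparable : ∀ ρ s v →
    v when ¬? (ρ ≤ᴾ? s) + v when (s ≟ ρ) ≤ v when (s ≤ᴾ? ρ) + v when incomparable? s ρ
  outside-or-self≤below-or-incomparable ρ s v with s ≟ ρ | s ≤ᴾ? ρ | ρ ≤ᴾ? s
  ... | yes refl | no ρ≰ρ | _ = ⊥-elim (ρ≰ρ ≤ᴾ-refl)
  ... | yes refl | yes _ | no ρ≰ρ = ⊥-elim (ρ≰ρ ≤ᴾ-refl)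
  ... | yes refl | yes _ | yes _ = m≤m+n v 0
  ... | no _ | yes _ | yes _ = z≤n
  ... | no _ | yes _ | no _ = ≤-refl
  ... | no _ | no _ | yes _ = z≤n
  ... | no _ | no _ | no _ = ≤-reflexive (+-identityʳ v)

  atom-separator : IsAtomic → ∀ {p ρ} → ¬ p ≤ᴾ ρ → ∃ λ c → Atom c × c ≤ᴾ p × ¬ c ≤ᴾ ρ
  atom-separator atomic {p} {ρ} p≰ρ with p ≟ ⊥
  ... | yes refl = ⊥-elim (p≰ρ (minimum ρ))
  ... | no p≢⊥ with atomic p p≢⊥
  ...   | S , S-atoms , refl with ⋁≰⇒∃≰ p≰ρ
  ...     | c , c∈S , c≰ρ = c , S-atoms c c∈S , ⋁-ub c∈S , c≰ρ

  atom-≤-atom : ∀ {a b} → Atom a → Atom b → b ≤ᴾ a → b ≡ a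
  atom-≤-atom (_ , below-a) (b≢⊥ , _) b≤a with below-a _ b≤a
  ... | inj₁ b≡⊥ = ⊥-elim (b≢⊥ b≡⊥)
  ... | inj₂ b≡a = b≡a

module Coordinatization {n k : ℕ} (P : FinLattice n) (m : Fin n → Mon k) where
  open Lat P
  open Labeling m
  open LatticeFacts P
  open IsBoundedLattice isBoundedLattice
    using (x≤x∨y; y≤x∨y; ∨-least; x∧y≤x; x∧y≤y; ∧-greatest; minimum; antisym)
    renaming (refl to ≤ᴾ-refl; trans to ≤ᴾ-trans)

  deg : Fin k → Fin n → ℕ
  deg j s = lookup (m s) j

  lcmₓ : Subset n → Mon k
  lcmₓ T = lcmL (map xₐ (members T))

  lookup-xₐ : ∀ j a → lookup (xₐ a) j ≡ sum (λ s → deg j s when ¬? (a ≤ᴾ? s))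
  lookup-xₐ j a = lookup-prodL-filter (λ s → ¬? (a ≤ᴾ? s)) m j

  lcmₓ-ub : ∀ j {T b} → b ∈ T → lookup (xₐ b) j ≤ lookup (lcmₓ T) j
  lcmₓ-ub j b∈T = lcmL-ub j (∈-map⁺ xₐ (∈-filter⁺ (_∈? _) (∈-allFin _) b∈T))

  lcmₓ-lub : ∀ j {B} T → (∀ b → b ∈ T → lookup (xₐ b) j ≤ B) → lookup (lcmₓ T) j ≤ B
  lcmₓ-lub j {B} T h = lcmL-lub j (map xₐ (members T)) bound
    where
    bound : ∀ {u} → u ∈ₗ map xₐ (members T) → lookup u j ≤ B
    bound u∈ with b , b∈ , refl ← ∈-map⁻ xₐ u∈ = h b (proj₂ (∈-filter⁻ (_∈? T) {xs = allFin n} b∈))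

  candidates : Fin n → List (Subset n)
  candidates a = filter (InUnionB? a) (allSubsets n)

  lcmₓ-∈-candidates : ∀ {a T} → InUnionB a T → lcmₓ T ∈ₗ map lcmₓ (candidates a)
  lcmₓ-∈-candidates {a} {T} a⊑T = ∈-map⁺ lcmₓ (∈-filter⁺ (InUnionB? a) (allSubsets-complete T) a⊑T)

  △-lb : ∀ j {a T} → InUnionB a T → lookup (△ a) j ≤ lookup (lcmₓ T) j
  △-lb j a⊑T = gcdL-lb j (lcmₓ-∈-candidates a⊑T)

  InUnionB-⁅⁆ : ∀ {a} → Atom a → InUnionB a ⁅ a ⁆
  InUnionB-⁅⁆ {a} a-atom = a , ≤ᴾ-refl , below , ⋁-⁅⁆ a
    where
    below : ∀ b → b ∈ ⁅ a ⁆ → Atom b × b ≤ᴾ a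
    below b b∈⁅a⁆ with refl ← x∈⁅y⁆⇒x≡y a b∈⁅a⁆ = a-atom , ≤ᴾ-refl

  △-attained : ∀ j {a} → Atom a → ∃ λ T → InUnionB a T × lookup (lcmₓ T) j ≡ lookup (△ a) j
  △-attained j {a} a-atom
    with u , u∈ , uⱼ≡△ ← gcdL-attained j (lcmₓ-∈-candidates (InUnionB-⁅⁆ a-atom))
    with T , T∈ , refl ← ∈-map⁻ lcmₓ u∈
    = T , proj₂ (∈-filter⁻ (InUnionB? a) {xs = allSubsets n} T∈) , uⱼ≡△

  △-glb : ∀ j {a B} → Atom a → (∀ T → InUnionB a T → B ≤ lookup (lcmₓ T) j) → B ≤ lookup (△ a) j
  △-glb j a-atom h with T , a⊑T , lcmₓT≡△ ← △-attained j a-atom = ≤-trans (h T a⊑T) (≤-reflexive lcmₓT≡△)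

  △≤xₐ : ∀ j {a} → Atom a → lookup (△ a) j ≤ lookup (xₐ a) j
  △≤xₐ j {a} a-atom = ≤-trans (△-lb j (InUnionB-⁅⁆ a-atom)) (lcmₓ-lub j ⁅ a ⁆ xₐ-of-member)
    where
    xₐ-of-member : ∀ b → b ∈ ⁅ a ⁆ → lookup (xₐ b) j ≤ lookup (xₐ a) j
    xₐ-of-member b b∈⁅a⁆ with refl ← x∈⁅y⁆⇒x≡y a b∈⁅a⁆ = ≤-refl

  downWeight outsideUpWeight incomparableWeight : Fin k → Fin n → ℕ
  downWeight j ρ = sum (λ s → deg j s when (s ≤ᴾ? ρ))
  outsideUpWeight j ρ = sum (λ s → deg j s when ¬? (ρ ≤ᴾ? s))
  incomparableWeight j ρ = sum (λ s → deg j s when incomparable? s ρ)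

  xₐ≤outsideUpWeight : ∀ j {b ρ} → b ≤ᴾ ρ → lookup (xₐ b) j ≤ outsideUpWeight j ρ
  xₐ≤outsideUpWeight j {b} {ρ} b≤ρ rewrite lookup-xₐ j b = sum-mono-≤ λ s →
    when-mono (¬? (b ≤ᴾ? s)) (¬? (ρ ≤ᴾ? s)) (deg j s) (λ b≰s ρ≤s → b≰s (≤ᴾ-trans b≤ρ ρ≤s))

  downWeight≤xₐ : ∀ j {b ρ} → ¬ b ≤ᴾ ρ → downWeight j ρ ≤ lookup (xₐ b) j
  downWeight≤xₐ j {b} {ρ} b≰ρ rewrite lookup-xₐ j b = sum-mono-≤ λ s →
    when-mono (s ≤ᴾ? ρ) (¬? (b ≤ᴾ? s)) (deg j s) (λ s≤ρ b≤s → b≰ρ (≤ᴾ-trans b≤s s≤ρ))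

  -- Every T ∈ B_q with q ≥ c has a member outside ↓ρ, since c ≰ ρ.
  downWeight≤△ : ∀ j {c ρ} → Atom c → ¬ c ≤ᴾ ρ → downWeight j ρ ≤ lookup (△ c) j
  downWeight≤△ j {c} {ρ} c-atom c≰ρ = △-glb j c-atom bound
    where
    bound : ∀ T → InUnionB c T → downWeight j ρ ≤ lookup (lcmₓ T) j
    bound T (q , c≤q , _ , refl) with b , b∈T , b≰ρ ← ⋁≰⇒∃≰ (λ ⋁T≤ρ → c≰ρ (≤ᴾ-trans c≤q ⋁T≤ρ))
      = ≤-trans (downWeight≤xₐ j b≰ρ) (lcmₓ-ub j b∈T)

  outsideUp+self≤down+incomparable : ∀ j ρ →
    outsideUpWeight j ρ + deg j ρ ≤ downWeight j ρ + incomparableWeight j ρ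
  outsideUp+self≤down+incomparable j ρ = begin
    outsideUpWeight j ρ + deg j ρ
      ≡⟨ cong (outsideUpWeight j ρ +_) (sum-point (deg j) ρ) ⟨
    outsideUpWeight j ρ + sum (λ s → deg j s when (s ≟ ρ))
      ≡⟨ ∑-distrib-+ (λ s → deg j s when ¬? (ρ ≤ᴾ? s)) (λ s → deg j s when (s ≟ ρ)) ⟨
    sum (λ s → deg j s when ¬? (ρ ≤ᴾ? s) + deg j s when (s ≟ ρ))
      ≤⟨ sum-mono-≤ (λ s → outside-or-self≤below-or-incomparable ρ s (deg j s)) ⟩
    sum (λ s → deg j s when (s ≤ᴾ? ρ) + deg j s when incomparable? s ρ)
      ≡⟨ ∑-distrib-+ (λ s → deg j s when (s ≤ᴾ? ρ)) (λ s → deg j s when incomparable? s ρ) ⟩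
    downWeight j ρ + incomparableWeight j ρ
      ∎
    where open ≤-Reasoning

  incomparableWeight≤ : ∀ j {ρ} u → (∀ s → Incomparable s ρ → s ≢ u → deg j s ≡ 0) →
    incomparableWeight j ρ ≤ deg j u when incomparable? u ρ
  incomparableWeight≤ j {ρ} u others-vanish = begin
    incomparableWeight j ρ                                       ≤⟨ sum-mono-≤ pointwise ⟩
    sum (λ s → (deg j s when incomparable? s ρ) when (s ≟ u))    ≡⟨ sum-point (λ s → deg j s when incomparable? s ρ) u ⟩
    deg j u when incomparable? u ρ                               ∎
    where
    open ≤-Reasoning
    pointwise : ∀ s → deg j s when incomparable? s ρ ≤ (deg j s when incomparable? s ρ) when (s ≟ u)
    pointwise s with s ≟ u
    ... | yes _ = ≤-refl
    ... | no s≢u = ≤-reflexive (when-vanishes (incomparable? s ρ) (deg j s) (λ s∥ρ → others-vanish s s∥ρ s≢u))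

  module _ (c1 : C1) (c2 : C2) where

    lone-incomparable-sharer : ∀ {ρ u} → Incomparable u ρ → gcdₘ (m ρ) (m u) ≢ one →
      ∃ λ j → deg j u < deg j ρ × (∀ s → Incomparable s ρ → s ≢ u → deg j s ≡ 0)
    lone-incomparable-sharer {ρ} {u} (u≰ρ , ρ≰u) shared with c2 ρ u shared
    ... | inj₁ (inj₁ ρ≤u) = ⊥-elim (ρ≰u ρ≤u)
    ... | inj₁ (inj₂ u≤ρ) = ⊥-elim (u≰ρ u≤ρ)
    ... | inj₂ (rρu≢one , _ , ρ-sharers-comparable , _)
        with j , degⱼu<degⱼρ ← /ₘgcdₘ≢one⇒exceeds (m ρ) (m u) rρu≢one
        = j , degⱼu<degⱼρ , vanish
      where
      degⱼρ≢0 : deg j ρ ≢ 0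
      degⱼρ≢0 = m<n⇒n≢0 degⱼu<degⱼρ
      vanish : ∀ s → Incomparable s ρ → s ≢ u → deg j s ≡ 0
      vanish s (s≰ρ , ρ≰s) s≢u = decidable-stable (deg j s ℕ.≟ 0) λ degⱼs≢0 →
        [ ρ≰s , s≰ρ ]′ (ρ-sharers-comparable ρ s
          ((λ { refl → ρ≰u ≤ᴾ-refl }) , common-variable⇒gcdₘ≢one (m ρ) (m ρ) j degⱼρ≢0 degⱼρ≢0)
          (s≢u , common-variable⇒gcdₘ≢one (m ρ) (m s) j degⱼρ≢0 degⱼs≢0))

    incomparableWeight<deg : ∀ {ρ} → MeetIrr ρ → ∃ λ j → incomparableWeight j ρ < deg j ρ
    incomparableWeight<deg {ρ} ρ-mi with i , degᵢρ≢0 ← ≢one⇒nonzero (m ρ) (c1 ρ ρ-mi)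
      with any? (λ u → incomparable? u ρ ×-dec ¬? (deg i u ℕ.≟ 0))
    -- No incomparable label contains variable i; take u := ρ, not incomparable to itself.
    ... | no none = i , (begin-strict
      incomparableWeight i ρ
        ≤⟨ incomparableWeight≤ i ρ (λ s s∥ρ _ → decidable-stable (deg i s ℕ.≟ 0) (λ ≢0 → none (s , s∥ρ , ≢0))) ⟩
      deg i ρ when incomparable? ρ ρ
        ≡⟨ when-vanishes (incomparable? ρ ρ) (deg i ρ) (λ (ρ≰ρ , _) → ⊥-elim (ρ≰ρ ≤ᴾ-refl)) ⟩
      0
        <⟨ n≢0⇒n>0 degᵢρ≢0 ⟩
      deg i ρ
        ∎)
      where open ≤-Reasoning
    ... | yes (u , u∥ρ , degᵢu≢0)
        with j , degⱼu<degⱼρ , others-vanish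
               ← lone-incomparable-sharer u∥ρ (common-variable⇒gcdₘ≢one (m ρ) (m u) i degᵢρ≢0 degᵢu≢0)
        = j , (begin-strict
      incomparableWeight j ρ              ≤⟨ incomparableWeight≤ j u others-vanish ⟩
      deg j u when incomparable? u ρ      ≤⟨ when-≤ (incomparable? u ρ) (deg j u) ⟩
      deg j u                             <⟨ degⱼu<degⱼρ ⟩
      deg j ρ                             ∎)
      where open ≤-Reasoning

    outsideUpWeight<downWeight : ∀ {ρ} → MeetIrr ρ → ∃ λ j → outsideUpWeight j ρ < downWeight j ρ
    outsideUpWeight<downWeight {ρ} ρ-mi with j , incomparable<deg ← incomparableWeight<deg ρ-mi =
      j , +-cancelʳ-< (deg j ρ) (outsideUpWeight j ρ) (downWeight j ρ)
            (≤-<-trans (outsideUp+self≤down+incomparable j ρ) (+-monoʳ-< (downWeight j ρ) incomparable<deg))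

  atomsBelow : Fin n → List (Fin n)
  atomsBelow p = filter (λ a → Atom? a ×-dec (a ≤ᴾ? p)) (allFin n)

  g : Fin n → Mon k
  g p = lcmL (map △ (atomsBelow p))

  g-ub : ∀ j {a p} → Atom a → a ≤ᴾ p → lookup (△ a) j ≤ lookup (g p) j
  g-ub j a-atom a≤p = lcmL-ub j (∈-map⁺ △ (∈-filter⁺ (λ a → Atom? a ×-dec (a ≤ᴾ? _)) (∈-allFin _) (a-atom , a≤p)))

  g-lub : ∀ j {p B} → (∀ a → Atom a → a ≤ᴾ p → lookup (△ a) j ≤ B) → lookup (g p) j ≤ B
  g-lub j {p} {B} h = lcmL-lub j (map △ (atomsBelow p)) bound
    where
    bound : ∀ {u} → u ∈ₗ map △ (atomsBelow p) → lookup u j ≤ B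
    bound u∈ with a , a∈ , refl ← ∈-map⁻ △ u∈
      with a-atom , a≤p ← proj₂ (∈-filter⁻ (λ a → Atom? a ×-dec (a ≤ᴾ? p)) {xs = allFin n} a∈)
      = h a a-atom a≤p

  g-mono : ∀ {p q} → p ≤ᴾ q → g p ∣ₘ g q
  g-mono p≤q j = g-lub j (λ a a-atom a≤p → g-ub j a-atom (≤ᴾ-trans a≤p p≤q))

  g-atom : ∀ {a} → Atom a → g a ≡ △ a
  g-atom {a} a-atom = lookup-ext λ j → ℕ.≤-antisym
    (g-lub j (λ b b-atom b≤a → ≤-reflexive (cong (λ z → lookup (△ z) j) (atom-≤-atom a-atom b-atom b≤a))))
    (g-ub j a-atom ≤ᴾ-refl)

  g-reflects-≤ : IsAtomic → C1 → C2 → ∀ {p q} → g p ∣ₘ g q → p ≤ᴾ q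
  g-reflects-≤ atomic c1 c2 {p} {q} gp∣gq = decidable-stable (p ≤ᴾ? q) λ p≰q →
    let ρ , ρ-mi , q≤ρ , p≰ρ = meetIrreducible-separator p≰q
        c , c-atom , c≤p , c≰ρ = atom-separator atomic p≰ρ
        j , outside<down = outsideUpWeight<downWeight c1 c2 ρ-mi
    in <⇒≱ outside<down (begin
      downWeight j ρ          ≤⟨ downWeight≤△ j c-atom c≰ρ ⟩
      lookup (△ c) j          ≤⟨ g-ub j c-atom c≤p ⟩
      lookup (g p) j          ≤⟨ gp∣gq j ⟩
      lookup (g q) j          ≤⟨ g-lub j (λ a a-atom a≤q →
                                   ≤-trans (△≤xₐ j a-atom) (xₐ≤outsideUpWeight j (≤ᴾ-trans a≤q q≤ρ))) ⟩
      outsideUpWeight j ρ     ∎)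
    where open ≤-Reasoning

  Cover : Fin k → List (Fin n) → Subset n → Set
  Cover j as T = (∀ t → t ∈ T → Atom t) × ⋁ₗ as ≤ᴾ ⋁ T
               × (∀ t → t ∈ T → lookup (xₐ t) j ≤ lookup (lcmL (map △ as)) j)

  -- T is the union of subsets attaining the minimum in each △(a)_j.
  cover : ∀ j {as} → All Atom as → ∃ (Cover j as)
  cover j [] = ∅ , (λ _ t∈∅ → ⊥-elim (∉⊥ t∈∅)) , minimum _ , (λ _ t∈∅ → ⊥-elim (∉⊥ t∈∅))
  cover j {a ∷ as} (a-atom ∷ as-atoms)
    with T₀ , (_ , a≤⋁T₀ , T₀-in-B , refl) , lcmₓT₀≡△a ← △-attained j a-atom
    with T , T-atoms , ⋁as≤⋁T , T-bounded ← cover j as-atoms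
    = T₀ ∪ T , atoms , ∨-least (≤ᴾ-trans a≤⋁T₀ (⋁-mono (λ _ → x∈p∪q⁺ ∘ inj₁)))
                                (≤ᴾ-trans ⋁as≤⋁T (⋁-mono (λ _ → x∈p∪q⁺ ∘ inj₂))) , bounded
    where
    atoms : ∀ t → t ∈ T₀ ∪ T → Atom t
    atoms t t∈ with x∈p∪q⁻ T₀ T t∈
    ... | inj₁ t∈T₀ = proj₁ (T₀-in-B t t∈T₀)
    ... | inj₂ t∈T = T-atoms t t∈T
    bounded : ∀ t → t ∈ T₀ ∪ T → lookup (xₐ t) j ≤ lookup (lcmL (△ a ∷ map △ as)) j
    bounded t t∈ with x∈p∪q⁻ T₀ T t∈
    ... | inj₁ t∈T₀ = ≤-trans (lcmₓ-ub j t∈T₀) (≤-trans (≤-reflexive lcmₓT₀≡△a) (lcmL-ub j {△ a ∷ map △ as} (here refl)))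
    ... | inj₂ t∈T = ≤-trans (T-bounded t t∈T) (lcmL-lub j (map △ as) (λ u∈ → lcmL-ub j {△ a ∷ map △ as} (there u∈)))

  △≤lcm-of-join : ∀ j {as c} → All Atom as → c ≤ᴾ ⋁ₗ as → lookup (△ c) j ≤ lookup (lcmL (map △ as)) j
  △≤lcm-of-join j as-atoms c≤⋁as with T , T-atoms , ⋁as≤⋁T , T-bounded ← cover j as-atoms
    = ≤-trans (△-lb j (⋁ T , ≤ᴾ-trans c≤⋁as ⋁as≤⋁T , (λ t t∈T → T-atoms t t∈T , ⋁-ub t∈T) , refl))
              (lcmₓ-lub j T T-bounded)

  g-⋁ₗ : ∀ {as} → All Atom as → g (⋁ₗ as) ≡ lcmL (map △ as)
  g-⋁ₗ {as} as-atoms = lookup-ext λ j → ℕ.≤-antisym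
    (g-lub j (λ c _ c≤⋁as → △≤lcm-of-join j as-atoms c≤⋁as))
    (lcmL-lub j (map △ as) (bound j))
    where
    bound : ∀ j {u} → u ∈ₗ map △ as → lookup u j ≤ lookup (g (⋁ₗ as)) j
    bound j u∈ with a , a∈as , refl ← ∈-map⁻ △ u∈ = g-ub j (All.lookup as-atoms a∈as) (⋁ₗ-ub a∈as)

  generators⇒atoms : ∀ {L} → All Gen L → ∃ λ as → All Atom as × map △ as ≡ L
  generators⇒atoms [] = [] , [] , refl
  generators⇒atoms ((a , a-atom , refl) ∷ gens) with as , as-atoms , refl ← generators⇒atoms gens
    = a ∷ as , a-atom ∷ as-atoms , refl

  g-surjective : ∀ u → InLCM u → ∃ λ x → g x ≡ u
  g-surjective _ (L , L-minGens , refl) with as , as-atoms , refl ← generators⇒atoms (All.map proj₁ L-minGens)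
    = ⋁ₗ as , g-⋁ₗ as-atoms

  module _ (g-reflects : ∀ {p q} → g p ∣ₘ g q → p ≤ᴾ q) where

    g-injective : ∀ x y → g x ≡ g y → x ≡ y
    g-injective x y gx≡gy = antisym (g-reflects (λ j → ≤-reflexive (cong (λ u → lookup u j) gx≡gy)))
                                    (g-reflects (λ j → ≤-reflexive (cong (λ u → lookup u j) (sym gx≡gy))))

    △-minGen : ∀ {a} → Atom a → MinGen (△ a)
    △-minGen {a} a-atom = (a , a-atom , refl) , minimal
      where
      minimal : ∀ v → Gen v → v ∣ₘ △ a → v ≡ △ a
      minimal _ (b , b-atom , refl) △b∣△a = cong △ (atom-≤-atom a-atom b-atom
        (g-reflects (subst₂ _∣ₘ_ (sym (g-atom b-atom)) (sym (g-atom a-atom)) △b∣△a)))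

    g-inLCM : ∀ x → InLCM (g x)
    g-inLCM x = map △ (atomsBelow x) , All.tabulate minGen , refl
      where
      minGen : ∀ {u} → u ∈ₗ map △ (atomsBelow x) → MinGen u
      minGen u∈ with a , a∈ , refl ← ∈-map⁻ △ u∈ =
        △-minGen (proj₁ (proj₂ (∈-filter⁻ (λ a → Atom? a ×-dec (a ≤ᴾ? x)) {xs = allFin n} a∈)))

    g-join : ∀ x y → IsJoinIn (g x) (g y) (g (x ∨ y))
    g-join x y = g-inLCM (x ∨ y) , g-mono (x≤x∨y x y) , g-mono (y≤x∨y x y) , least
      where
      least : ∀ z → InLCM z → g x ∣ₘ z → g y ∣ₘ z → g (x ∨ y) ∣ₘ z
      least z z∈ with v , refl ← g-surjective z z∈ =
        λ gx∣gv gy∣gv → g-mono (∨-least (g-reflects gx∣gv) (g-reflects gy∣gv))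

    g-meet : ∀ x y → IsMeetIn (g x) (g y) (g (x ∧ y))
    g-meet x y = g-inLCM (x ∧ y) , g-mono (x∧y≤x x y) , g-mono (x∧y≤y x y) , greatest
      where
      greatest : ∀ z → InLCM z → z ∣ₘ g x → z ∣ₘ g y → z ∣ₘ g (x ∧ y)
      greatest z z∈ with v , refl ← g-surjective z z∈ =
        λ gv∣gx gv∣gy → g-mono (∧-greatest (g-reflects gv∣gx) (g-reflects gv∣gy))

    weakCoordinatization : WeakCoordinatization
    weakCoordinatization = g , (g-inLCM , g-injective , g-surjective , g-join , g-meet) , λ _ → g-atom

theorem3p1 : ∀ {n k : ℕ} (P : FinLattice n) → Lat.IsAtomic P →
    (m : Fin n → Mon k) →
    Lat.Labeling.C1 P m → Lat.Labeling.C2 P m →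
    Lat.Labeling.WeakCoordinatization P m
theorem3p1 P atomic m c1 c2 =
  weakCoordinatization (g-reflects-≤ atomic c1 c2)
  where open Coordinatization P m
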